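{- Let $k\ge 2$, let $H_0$ be a finite $k$-uniform hypergraph and let $G$ be the 2-section of $H_0$. Then for every nonnegative integer $t$, the graph $\mathrm{ILT}'_t(G)$ is the 2-section of $\mathrm{ILTH}_t(H_0)$.
   Context: The 2-section of a hypergraph $H$ is the graph on $V(H)$ in which distinct $u,v$ are adjacent iff some hyperedge of $H$ contains both. ILTH model: given $H_t$ (with $H_0$ fixed), $H_{t+1}$ has vertex set $V(H_t)\cup\{x':x\in V(H_t)\}$ where each $x'$ is a new vertex (the clone of $x$), and hyperedge set $E(H_t)\cup\{(e\setminus\{x\})\cup\{x'\}: e\in E(H_t), x\in e\}$; $\mathrm{ILTH}_t(H_0)=H_t$. The graph process $\mathrm{ILT}'$: $\mathrm{ILT}'_0(G)=G$; given $\mathrm{ILT}'_t(G)$, the graph $\mathrm{ILT}'_{t+1}(G)$ has vertex set $V(\mathrm{ILT}'_t(G))\cup\{v':v\in V(\mathrm{ILT}'_t(G))\}$ (new vertices $v'$), and for each edge $uv$ of $\mathrm{ILT}'_t(G)$ it contains the edges $uv$, $uv'$ and $u'v$, and no other edges. -}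

module Defs where

open import Data.Nat using (ℕ; zero; suc)
open import Data.Fin using (Fin)
open import Data.Sum using (_⊎_; inj₁; inj₂)
open import Data.Product using (Σ; _×_)
open import Data.Empty using (⊥)
open import Data.List using (List; _++_; concatMap)
import Data.List as List
open import Data.List.Membership.Propositional using () renaming (_∈_ to _∈ₗ_)
open import Data.Vec using (Vec; lookup; _[_]≔_)
import Data.Vec as Vec
open import Data.Vec.Membership.Propositional using () renaming (_∈_ to _∈ᵥ_)
open import Data.List using (allFin)
open import Relation.Binary.PropositionalEquality using (_≡_; _≢_)

-- A (finite) hypergraph on vertex type V whose hyperedges are given as a
-- finite list; each hyperedge is a vector of its k vertices (k-uniformity
-- additionally requires the k entries to be pairwise distinct, see Uniform).
record Hypergraph (V : Set) (k : ℕ) : Set where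
  constructor hypergraph
  field
    edges : List (Vec V k)
open Hypergraph public

Uniform : ∀ {V k} → Hypergraph V k → Set
Uniform {k = k} H = ∀ e → e ∈ₗ edges H → (i j : Fin k) → lookup e i ≡ lookup e j → i ≡ j

Graph : Set → Set₁
Graph V = V → V → Set

TwoSection : ∀ {V k} → Hypergraph V k → Graph V
TwoSection H u v = u ≢ v × Σ _ (λ e → e ∈ₗ edges H × u ∈ᵥ e × v ∈ᵥ e)

-- Vertex type after t cloning steps, starting from V0:
-- V_{t+1} = V_t ⊎ V_t, where inj₁ x is the old vertex x and inj₂ x its clone x'.
Vtx : Set → ℕ → Set
Vtx V0 zero    = V0
Vtx V0 (suc t) = Vtx V0 t ⊎ Vtx V0 t

-- One ILTH step: keep every hyperedge e, and for every e and every x ∈ e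
-- (x = the i-th vertex of e) add (e ∖ {x}) ∪ {x'}.
ilthStep : ∀ {V k} → Hypergraph V k → Hypergraph (V ⊎ V) k
ilthStep {k = k} H = hypergraph
  (List.map (Vec.map inj₁) (edges H)
   ++ concatMap (λ e → List.map (λ i → Vec.map inj₁ e [ i ]≔ inj₂ (lookup e i)) (allFin k)) (edges H))

ILTH : ∀ {V0 k} → (t : ℕ) → Hypergraph V0 k → Hypergraph (Vtx V0 t) k
ILTH zero    H = H
ILTH (suc t) H = ilthStep (ILTH t H)

iltStep : ∀ {V} → Graph V → Graph (V ⊎ V)
iltStep R (inj₁ a) (inj₁ b) = R a b
iltStep R (inj₁ a) (inj₂ b) = R a b
iltStep R (inj₂ a) (inj₁ b) = R a b
iltStep R (inj₂ a) (inj₂ b) = ⊥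

ILT′ : ∀ {V0} → (t : ℕ) → Graph V0 → Graph (Vtx V0 t)
ILT′ zero    G = G
ILT′ (suc t) G = iltStep (ILT′ t G)

-- The old–old adjacencies of ILTH_{t+1} come from the kept hyperedges, and a
-- cloned hyperedge (e ∖ {x}) ∪ {x'} contains exactly one clone, x', together
-- with the old vertices of e other than x.  Hence two clones are never
-- adjacent, and x' is adjacent to an old vertex y iff x and y lie in a common
-- hyperedge and y ≠ x — which is the rule defining ILT′.
module Submission where

open import Defs
open import Data.Nat using (ℕ; _≤_; zero; suc)
open import Data.Fin using (Fin; _≟_)
open import Data.Sum using (_⊎_; inj₁; inj₂)
open import Data.Sum.Properties using (inj₁-injective; inj₂-injective)
open import Data.Product using (Σ; ∃; _×_; _,_)
open import Data.Empty using (⊥-elim)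
open import Data.List using (allFin)
import Data.List as List
open import Data.List.Relation.Unary.Any as ListAny using ()
open import Data.List.Membership.Propositional using (find) renaming (_∈_ to _∈ₗ_)
open import Data.List.Membership.Propositional.Properties
  using (∈-++⁻; ∈-++⁺ˡ; ∈-++⁺ʳ; ∈-map⁻; ∈-map⁺; ∈-concatMap⁻; ∈-concatMap⁺; ∈-allFin)
open import Data.Vec using (Vec; lookup; _[_]≔_; _∷_)
import Data.Vec as Vec
open import Data.Vec.Relation.Unary.Any using (here; there; index)
open import Data.Vec.Relation.Unary.Any.Properties using (lookup-index)
open import Data.Vec.Membership.Propositional using () renaming (_∈_ to _∈ᵥ_)
open import Data.Vec.Membership.Propositional.Properties using (∈-lookup)
import Data.Vec.Membership.Propositional.Properties as VecMembership
open import Data.Vec.Properties using (lookup∘update; lookup∘update′; lookup-map)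
open import Function.Bundles using (_⇔_; mk⇔)
import Function.Properties.Equivalence as ⇔
open import Relation.Binary.PropositionalEquality
open import Relation.Nullary using (yes; no; ¬_)

private
  variable
    V : Set
    k : ℕ
    a b : V

∈⇒lookup : {x : V} {xs : Vec V k} → x ∈ᵥ xs → Σ (Fin k) λ i → x ≡ lookup xs i
∈⇒lookup x∈xs = index x∈xs , lookup-index x∈xs

∈-lookup′ : {x : V} (xs : Vec V k) (i : Fin k) → x ≡ lookup xs i → x ∈ᵥ xs
∈-lookup′ xs i refl = ∈-lookup i xs

Distinct : Vec V k → Set
Distinct {k = k} e = (i j : Fin k) → lookup e i ≡ lookup e j → i ≡ j

cloneAt : Vec V k → Fin k → Vec (V ⊎ V) k
cloneAt e i = Vec.map inj₁ e [ i ]≔ inj₂ (lookup e i)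

lookup-cloneAt-≡ : (e : Vec V k) (i : Fin k) → lookup (cloneAt e i) i ≡ inj₂ (lookup e i)
lookup-cloneAt-≡ e i = lookup∘update i (Vec.map inj₁ e) _

lookup-cloneAt-≢ : (e : Vec V k) {i j : Fin k} → j ≢ i → lookup (cloneAt e i) j ≡ inj₁ (lookup e j)
lookup-cloneAt-≢ e {i} {j} j≢i = trans (lookup∘update′ j≢i (Vec.map inj₁ e) _) (lookup-map j inj₁ e)

lookup-cloneAt : (e : Vec V k) (i j : Fin k) →
  (j ≡ i × lookup (cloneAt e i) j ≡ inj₂ (lookup e j)) ⊎
  (j ≢ i × lookup (cloneAt e i) j ≡ inj₁ (lookup e j))
lookup-cloneAt e i j with j ≟ i
... | yes refl = inj₁ (refl , lookup-cloneAt-≡ e i)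
... | no j≢i   = inj₂ (j≢i , lookup-cloneAt-≢ e j≢i)

inj₁∈cloneAt⁻ : {e : Vec V k} {i : Fin k} → inj₁ a ∈ᵥ cloneAt e i →
  Σ (Fin k) λ j → j ≢ i × a ≡ lookup e j
inj₁∈cloneAt⁻ {e = e} {i} a∈ with ∈⇒lookup a∈
... | j , a≡ with lookup-cloneAt e i j
...   | inj₁ (_ , eq)    with () ← trans a≡ eq
...   | inj₂ (j≢i , eq) = j , j≢i , inj₁-injective (trans a≡ eq)

inj₂∈cloneAt⁻ : {e : Vec V k} {i : Fin k} → inj₂ b ∈ᵥ cloneAt e i → b ≡ lookup e i
inj₂∈cloneAt⁻ {e = e} {i} b∈ with ∈⇒lookup b∈
... | j , b≡ with lookup-cloneAt e i j
...   | inj₁ (refl , eq) = inj₂-injective (trans b≡ eq)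
...   | inj₂ (_ , eq)    with () ← trans b≡ eq

inj₁∈map⁻ : {e : Vec V k} → inj₁ a ∈ᵥ Vec.map (inj₁ {B = V}) e → a ∈ᵥ e
inj₁∈map⁻ {e = _ ∷ _} (here eq)  = here (inj₁-injective eq)
inj₁∈map⁻ {e = _ ∷ _} (there a∈) = there (inj₁∈map⁻ a∈)

inj₂∉map : {e : Vec V k} → ¬ (inj₂ b ∈ᵥ Vec.map (inj₁ {B = V}) e)
inj₂∉map {e = _ ∷ _} (there b∈) = inj₂∉map b∈

data _↝_ {V : Set} {k : ℕ} (e : Vec V k) : Vec (V ⊎ V) k → Set where
  kept   : e ↝ Vec.map inj₁ e
  cloned : (i : Fin k) → e ↝ cloneAt e i

module _ (H : Hypergraph V k) where

  ∈-ilthStep⁺ : {e : Vec V k} {e′ : Vec (V ⊎ V) k} →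
    e ∈ₗ edges H → e ↝ e′ → e′ ∈ₗ edges (ilthStep H)
  ∈-ilthStep⁺ e∈ kept       = ∈-++⁺ˡ (∈-map⁺ (Vec.map inj₁) e∈)
  ∈-ilthStep⁺ e∈ (cloned i) = ∈-++⁺ʳ (List.map (Vec.map inj₁) (edges H))
    (∈-concatMap⁺ (λ e → List.map (cloneAt e) (allFin k))
      (ListAny.map (λ { refl → ∈-map⁺ (cloneAt _) (∈-allFin i) }) e∈))

  ∈-ilthStep⁻ : {e′ : Vec (V ⊎ V) k} →
    e′ ∈ₗ edges (ilthStep H) → ∃ λ e → e ∈ₗ edges H × e ↝ e′
  ∈-ilthStep⁻ e′∈ with ∈-++⁻ (List.map (Vec.map inj₁) (edges H)) e′∈
  ... | inj₁ e′∈kept with ∈-map⁻ (Vec.map inj₁) e′∈kept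
  ...   | e , e∈ , refl = e , e∈ , kept
  ∈-ilthStep⁻ e′∈ | inj₂ e′∈cloned
    with find (∈-concatMap⁻ (λ e → List.map (cloneAt e) (allFin k)) {xs = edges H} e′∈cloned)
  ...   | e , e∈ , e′∈clones with ∈-map⁻ (cloneAt e) e′∈clones
  ...     | i , _ , refl = e , e∈ , cloned i

↝-inj₁⁻ : {e : Vec V k} {e′ : Vec (V ⊎ V) k} → e ↝ e′ → inj₁ a ∈ᵥ e′ → a ∈ᵥ e
↝-inj₁⁻ kept           a∈ = inj₁∈map⁻ a∈
↝-inj₁⁻ {e = e} (cloned i) a∈ with inj₁∈cloneAt⁻ a∈
... | j , _ , a≡ = ∈-lookup′ e j a≡

↝-inj₂⁻ : {e : Vec V k} {e′ : Vec (V ⊎ V) k} → e ↝ e′ → inj₂ b ∈ᵥ e′ → b ∈ᵥ e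
↝-inj₂⁻ kept               b∈ = ⊥-elim (inj₂∉map b∈)
↝-inj₂⁻ {e = e} (cloned i) b∈ = ∈-lookup′ e i (inj₂∈cloneAt⁻ b∈)

↝-inj₂-unique : {e : Vec V k} {e′ : Vec (V ⊎ V) k} → e ↝ e′ →
  inj₂ a ∈ᵥ e′ → inj₂ b ∈ᵥ e′ → a ≡ b
↝-inj₂-unique kept       a∈ _  = ⊥-elim (inj₂∉map a∈)
↝-inj₂-unique (cloned i) a∈ b∈ = trans (inj₂∈cloneAt⁻ a∈) (sym (inj₂∈cloneAt⁻ b∈))

-- Distinctness is needed: if x occurred twice in e, the clone edge at one
-- occurrence would make x adjacent to its own clone x′.
↝-inj₁-inj₂-≢ : {e : Vec V k} {e′ : Vec (V ⊎ V) k} → Distinct e → e ↝ e′ →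
  inj₁ a ∈ᵥ e′ → inj₂ b ∈ᵥ e′ → a ≢ b
↝-inj₁-inj₂-≢ _ kept _ b∈ = ⊥-elim (inj₂∉map b∈)
↝-inj₁-inj₂-≢ distinct (cloned i) a∈ b∈ a≡b with inj₁∈cloneAt⁻ a∈
... | j , j≢i , a≡ = j≢i (distinct j i (trans (sym a≡) (trans a≡b (inj₂∈cloneAt⁻ b∈))))

↝-distinct : {e : Vec V k} {e′ : Vec (V ⊎ V) k} → Distinct e → e ↝ e′ → Distinct e′
↝-distinct {e = e} distinct kept i j eq =
  distinct i j (inj₁-injective (trans (sym (lookup-map i inj₁ e)) (trans eq (lookup-map j inj₁ e))))
↝-distinct {e = e} distinct (cloned m) i j eq with lookup-cloneAt e m i | lookup-cloneAt e m j
... | inj₁ (refl , _) | inj₁ (refl , _) = refl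
... | inj₁ (_ , eqᵢ)   | inj₂ (_ , eqⱼ)  with () ← trans (sym eqᵢ) (trans eq eqⱼ)
... | inj₂ (_ , eqᵢ)   | inj₁ (_ , eqⱼ)  with () ← trans (sym eqᵢ) (trans eq eqⱼ)
... | inj₂ (_ , eqᵢ)   | inj₂ (_ , eqⱼ)  =
  distinct i j (inj₁-injective (trans (sym eqᵢ) (trans eq eqⱼ)))

cloned-witness : {e : Vec V k} → a ≢ b → a ∈ᵥ e → b ∈ᵥ e →
  Σ (Fin k) λ i → inj₁ a ∈ᵥ cloneAt e i × inj₂ b ∈ᵥ cloneAt e i
cloned-witness {e = e} a≢b a∈ b∈ with ∈⇒lookup a∈ | ∈⇒lookup b∈
... | j , refl | i , refl =
  i , ∈-lookup′ (cloneAt e i) j (sym (lookup-cloneAt-≢ e j≢i))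
    , ∈-lookup′ (cloneAt e i) i (sym (lookup-cloneAt-≡ e i))
  where
  j≢i : j ≢ i
  j≢i refl = a≢b refl

ilthStep-uniform : (H : Hypergraph V k) → Uniform H → Uniform (ilthStep H)
ilthStep-uniform H uniform e′ e′∈ with ∈-ilthStep⁻ H e′∈
... | e , e∈ , e↝e′ = ↝-distinct (uniform e e∈) e↝e′

ILTH-uniform : (t : ℕ) {H₀ : Hypergraph V k} → Uniform H₀ → Uniform (ILTH t H₀)
ILTH-uniform zero uniform = uniform
ILTH-uniform (suc t) {H₀} uniform = ilthStep-uniform (ILTH t H₀) (ILTH-uniform t uniform)

TwoSection-sym : (H : Hypergraph V k) {u v : V} → TwoSection H u v ⇔ TwoSection H v u
TwoSection-sym H = mk⇔ swap swap
  where
  swap : ∀ {u v} → TwoSection H u v → TwoSection H v u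
  swap (u≢v , e , e∈ , u∈ , v∈) = (λ v≡u → u≢v (sym v≡u)) , e , e∈ , v∈ , u∈

module _ (H : Hypergraph V k) where

  TwoSection-inj₁-inj₁ : TwoSection H a b ⇔ TwoSection (ilthStep H) (inj₁ a) (inj₁ b)
  TwoSection-inj₁-inj₁ = mk⇔ to from
    where
    to : TwoSection H a b → TwoSection (ilthStep H) (inj₁ a) (inj₁ b)
    to (a≢b , e , e∈ , a∈ , b∈) =
      (λ eq → a≢b (inj₁-injective eq)) , Vec.map inj₁ e , ∈-ilthStep⁺ H e∈ kept ,
      VecMembership.∈-map⁺ inj₁ a∈ , VecMembership.∈-map⁺ inj₁ b∈
    from : TwoSection (ilthStep H) (inj₁ a) (inj₁ b) → TwoSection H a b
    from (a≢b , e′ , e′∈ , a∈ , b∈) with ∈-ilthStep⁻ H e′∈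
    ... | e , e∈ , e↝e′ = (λ eq → a≢b (cong inj₁ eq)) , e , e∈ , ↝-inj₁⁻ e↝e′ a∈ , ↝-inj₁⁻ e↝e′ b∈

  TwoSection-inj₁-inj₂ : Uniform H → TwoSection H a b ⇔ TwoSection (ilthStep H) (inj₁ a) (inj₂ b)
  TwoSection-inj₁-inj₂ uniform = mk⇔ to from
    where
    to : TwoSection H a b → TwoSection (ilthStep H) (inj₁ a) (inj₂ b)
    to (a≢b , e , e∈ , a∈ , b∈) with cloned-witness a≢b a∈ b∈
    ... | i , a∈′ , b∈′ = (λ ()) , cloneAt e i , ∈-ilthStep⁺ H e∈ (cloned i) , a∈′ , b∈′
    from : TwoSection (ilthStep H) (inj₁ a) (inj₂ b) → TwoSection H a b
    from (_ , e′ , e′∈ , a∈ , b∈) with ∈-ilthStep⁻ H e′∈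
    ... | e , e∈ , e↝e′ =
      ↝-inj₁-inj₂-≢ (uniform e e∈) e↝e′ a∈ b∈ , e , e∈ , ↝-inj₁⁻ e↝e′ a∈ , ↝-inj₂⁻ e↝e′ b∈

  ¬TwoSection-inj₂-inj₂ : ¬ TwoSection (ilthStep H) (inj₂ a) (inj₂ b)
  ¬TwoSection-inj₂-inj₂ (a≢b , e′ , e′∈ , a∈ , b∈) with ∈-ilthStep⁻ H e′∈
  ... | _ , _ , e↝e′ = a≢b (cong inj₂ (↝-inj₂-unique e↝e′ a∈ b∈))

  TwoSection-ilthStep : Uniform H → (u v : V ⊎ V) →
    iltStep (TwoSection H) u v ⇔ TwoSection (ilthStep H) u v
  TwoSection-ilthStep _       (inj₁ a) (inj₁ b) = TwoSection-inj₁-inj₁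
  TwoSection-ilthStep uniform (inj₁ a) (inj₂ b) = TwoSection-inj₁-inj₂ uniform
  TwoSection-ilthStep uniform (inj₂ a) (inj₁ b) =
    ⇔.trans (TwoSection-sym H) (⇔.trans (TwoSection-inj₁-inj₂ uniform) (TwoSection-sym (ilthStep H)))
  TwoSection-ilthStep _       (inj₂ a) (inj₂ b) = mk⇔ ⊥-elim ¬TwoSection-inj₂-inj₂

iltStep-cong : {R S : Graph V} → (∀ u v → R u v ⇔ S u v) → ∀ u v → iltStep R u v ⇔ iltStep S u v
iltStep-cong R⇔S (inj₁ a) (inj₁ b) = R⇔S a b
iltStep-cong R⇔S (inj₁ a) (inj₂ b) = R⇔S a b
iltStep-cong R⇔S (inj₂ a) (inj₁ b) = R⇔S a b
iltStep-cong R⇔S (inj₂ a) (inj₂ b) = ⇔.refl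

-- The hypothesis 2 ≤ k is unused: the argument works for every k.
lemma2 : (k n : ℕ) → 2 ≤ k → (H₀ : Hypergraph (Fin n) k) → Uniform H₀ →
    (t : ℕ) → (u v : Vtx (Fin n) t) →
    ILT′ t (TwoSection H₀) u v ⇔ TwoSection (ILTH t H₀) u v
lemma2 k n _  H₀ uniform zero    u v = ⇔.refl
lemma2 k n 2≤k H₀ uniform (suc t) u v =
  ⇔.trans (iltStep-cong (lemma2 k n 2≤k H₀ uniform t) u v)
          (TwoSection-ilthStep (ILTH t H₀) (ILTH-uniform t uniform) u v)
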